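{- Let $G=(V,E)$ be an unweighted graph, $S\subseteq V$ a cut, and $k$ a positive integer. Let $S'$ be the output of \textsc{StabilizeCut}$(G,S,k)$. Then $S'$ is $k$-stable, $C_{S'}\ge C_S$, and $\varphi(S',k)\ge\varphi(S,k)$. In particular, every unweighted graph $G=(V,E)$ has a $k$-stable cut $S^*$ with $\varphi(S^*,k)=\max_{S''\subseteq V}\varphi(S'',k)$.
   Context: For a cut $S\subseteq V$, $C_S$ is the number of edges with exactly one endpoint in $S$; $d(v)$ is the degree of $v$; $d_S(v)$ is the number of edges incident to $v$ crossing $S$. $S\oplus v$ is $S\setminus\{v\}$ if $v\in S$ and $S\cup\{v\}$ otherwise. Replacing $S$ by $S\oplus v$ is a $k$-greedy step if $d_S(v)\le (d(v)-k)/2$; $S$ is $k$-stable if it admits no $k$-greedy step, i.e., $d_S(v)>(d(v)-k)/2$ for all $v\in V$. \textsc{StabilizeCut}$(G,S,k)$ starts from $S$ and repeatedly applies an arbitrary $k$-greedy step while one exists, then returns the current cut. $\varphi(S,k)=\min_{F\subseteq V,|F|=k}C_{S-F,G-F}$, where $G-F$ deletes $F$ and incident edges. -}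

module Defs where

open import Data.Nat using (ℕ; zero; suc; _+_; _*_; _≤_; _<_; _<ᵇ_)
open import Data.Bool using (Bool; true; false; if_then_else_; _∧_; _xor_; not)
open import Data.Fin using (Fin; toℕ) renaming (zero to fzero; suc to fsuc)
open import Data.Fin.Subset using (Subset; ∣_∣)
open import Data.Vec using (lookup; updateAt)
open import Data.Product using (Σ; ∃; _×_)
open import Relation.Binary.PropositionalEquality using (_≡_)
open import Relation.Nullary using (¬_)
open import Relation.Binary.Construct.Closure.ReflexiveTransitive using (Star)

record Graph (n : ℕ) : Set where
  field
    adj    : Fin n → Fin n → Bool
    sym    : ∀ i j → adj i j ≡ adj j i
    irrefl : ∀ i → adj i i ≡ false
open Graph public

sumF : ∀ {n} → (Fin n → ℕ) → ℕ
sumF {zero}  f = 0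
sumF {suc n} f = f fzero + sumF (λ i → f (fsuc i))

countF : ∀ {n} → (Fin n → Bool) → ℕ
countF p = sumF (λ i → if p i then 1 else 0)

crosses : ∀ {n} → Subset n → Fin n → Fin n → Bool
crosses S i j = lookup S i xor lookup S j

-- Edges of G are unordered pairs {i,j}, counted once via toℕ i < toℕ j.
-- cutWithout G F S = C_{S-F, G-F}: crossing edges with no endpoint in F.
cutWithout : ∀ {n} → Graph n → Subset n → Subset n → ℕ
cutWithout G F S =
  sumF (λ i → countF (λ j → (toℕ i <ᵇ toℕ j) ∧ adj G i j ∧ crosses S i j
                             ∧ not (lookup F i) ∧ not (lookup F j)))

cutValue : ∀ {n} → Graph n → Subset n → ℕ
cutValue G S =
  sumF (λ i → countF (λ j → (toℕ i <ᵇ toℕ j) ∧ adj G i j ∧ crosses S i j))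

deg : ∀ {n} → Graph n → Fin n → ℕ
deg G v = countF (λ j → adj G v j)

degCut : ∀ {n} → Graph n → Subset n → Fin n → ℕ
degCut G S v = countF (λ j → adj G v j ∧ crosses S v j)

flip : ∀ {n} → Subset n → Fin n → Subset n
flip S v = updateAt S v not

-- d_S(v) ≤ (d(v) - k)/2, cleared of denominators (exact over ℕ).
GreedyCond : ∀ {n} → Graph n → ℕ → Subset n → Fin n → Set
GreedyCond G k S v = 2 * degCut G S v + k ≤ deg G v

GreedyStep : ∀ {n} → Graph n → ℕ → Subset n → Subset n → Set
GreedyStep G k S T = ∃ λ v → GreedyCond G k S v × T ≡ flip S v

-- k-stable: d_S(v) > (d(v) - k)/2 for all v, cleared of denominators.
Stable : ∀ {n} → Graph n → ℕ → Subset n → Set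
Stable G k S = ∀ v → deg G v < 2 * degCut G S v + k

-- S' is a possible output of StabilizeCut(G,S,k): reached from S by a finite
-- sequence of (arbitrarily chosen) k-greedy steps, and no k-greedy step exists.
StabilizeOutput : ∀ {n} → Graph n → ℕ → Subset n → Subset n → Set
StabilizeOutput G k S S' =
  Star (GreedyStep G k) S S' × (∀ T → ¬ GreedyStep G k S' T)

-- IsPhi G S k m : m = φ(S,k) = min_{|F|=k} C_{S-F,G-F} (attained and a lower bound).
IsPhi : ∀ {n} → Graph n → Subset n → ℕ → ℕ → Set
IsPhi G S k m =
  (Σ (Subset _) λ F → ∣ F ∣ ≡ k × cutWithout G F S ≡ m)
  × (∀ F → ∣ F ∣ ≡ k → m ≤ cutWithout G F S)

-- Fix F with |F| ≤ k and a vertex v ∉ F, and write P(S) for the number of cut edges of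
-- G − F at v. Flipping v changes C_{S−F,G−F} by P(S ⊕ v) − P(S), and P(S) + P(S ⊕ v) is
-- the degree of v in G − F, which is at least d(v) − |F| ≥ d(v) − k ≥ 2 d_S(v) ≥ 2 P(S)
-- for a k-greedy step; if v ∈ F the flip does not change C_{S−F,G−F} at all. So a
-- k-greedy step never decreases C_{S−F,G−F}, hence never decreases φ(·,k). For F = ∅ it
-- increases C_S by at least k ≥ 1, so StabilizeCut terminates, and stabilizing a
-- maximiser of φ(·,k) yields a stable maximiser.
module Submission where

open import Defs hiding (sym)
open import Data.Nat using (ℕ; zero; suc; _+_; _*_; _≤_; _<_; _<ᵇ_; _≡ᵇ_; z≤n; _≤?_)
open import Data.Nat.Properties
  using ( ≤-refl; ≤-reflexive; ≤-trans; <-≤-trans; ≤-totalPreorder; module ≤-Reasoning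
        ; +-assoc; +-identityʳ; +-suc; *-identityʳ; *-zeroʳ; +-mono-≤; +-monoˡ-≤; +-monoʳ-≤
        ; +-cancelˡ-≤; +-cancelʳ-≤; m≤m+n; m≤n+m; m<m+n; n≤0⇒n≡0; <⇒≱; ≰⇒>
        ; <⇒<ᵇ; <ᵇ⇒<; ≡⇒≡ᵇ; ≡ᵇ⇒≡; +-commutativeSemigroup; +-0-commutativeMonoid )
open import Data.Nat.Tactic.RingSolver using (solve-∀)
open import Algebra.Properties.CommutativeSemigroup +-commutativeSemigroup using (xy∙z≈xz∙y)
open import Data.Bool using (Bool; true; false; T; not; _∧_; _xor_; if_then_else_)
open import Data.Bool.Properties
  using (∧-zeroʳ; ∧-comm; ∧-identityʳ; xor-comm; not-distribˡ-xor; T-≡; ¬-not)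
open import Data.Fin using (Fin; toℕ; punchIn; _≟_) renaming (zero to fzero; suc to fsuc)
open import Data.Fin.Properties using (punchInᵢ≢i; any?) renaming (<-cmp to <-cmpᶠ)
open import Data.Fin.Subset using (Subset; ∣_∣; ⊥; inside; outside)
open import Data.Fin.Subset.Properties using (∣⊥∣≡0)
open import Data.Vec using ([]; _∷_; lookup)
open import Data.Vec.Properties using (lookup∘updateAt; lookup∘updateAt′; lookup-replicate)
open import Data.Product using (∃; _×_; _,_; proj₁; proj₂)
open import Data.Sum using (inj₁; inj₂)
open import Function using (_∘_; Equivalence)
open import Relation.Binary.Core using (Rel)
open import Relation.Binary.Bundles using (TotalPreorder)
import Relation.Binary.Construct.Flip.EqAndOrd as Flip
open import Relation.Binary.Definitions using (tri<; tri≈; tri>)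
open import Relation.Binary.PropositionalEquality
open import Relation.Nullary using (¬_; Dec; yes; no; contradiction)
open import Relation.Nullary.Decidable using (map′)
open import Relation.Binary.Construct.Closure.ReflexiveTransitive using (Star; ε; _◅_; fold)
open import Algebra.Properties.CommutativeMonoid.Sum +-0-commutativeMonoid
  using (sum; sum-cong-≗; ∑-distrib-+; sum-remove)

sumF≡sum : ∀ {n} (f : Fin n → ℕ) → sumF f ≡ sum f
sumF≡sum {zero}  f = refl
sumF≡sum {suc n} f = cong (f fzero +_) (sumF≡sum (f ∘ fsuc))

sumF-cong : ∀ {n} {f g : Fin n → ℕ} → (∀ i → f i ≡ g i) → sumF f ≡ sumF g
sumF-cong {f = f} {g} f≗g = begin
  sumF f ≡⟨ sumF≡sum f ⟩
  sum f  ≡⟨ sum-cong-≗ f≗g ⟩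
  sum g  ≡⟨ sumF≡sum g ⟨
  sumF g ∎
  where open ≡-Reasoning

sumF-+ : ∀ {n} (f g : Fin n → ℕ) → sumF (λ i → f i + g i) ≡ sumF f + sumF g
sumF-+ f g = begin
  sumF (λ i → f i + g i) ≡⟨ sumF≡sum (λ i → f i + g i) ⟩
  sum (λ i → f i + g i)  ≡⟨ ∑-distrib-+ f g ⟩
  sum f + sum g          ≡⟨ cong₂ _+_ (sumF≡sum f) (sumF≡sum g) ⟨
  sumF f + sumF g        ∎
  where open ≡-Reasoning

sumF-punchIn : ∀ {n} (v : Fin (suc n)) (f : Fin (suc n) → ℕ) →
               sumF f ≡ f v + sumF (f ∘ punchIn v)
sumF-punchIn v f = begin
  sumF f                      ≡⟨ sumF≡sum f ⟩
  sum f                       ≡⟨ sum-remove {i = v} f ⟩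
  f v + sum (f ∘ punchIn v)   ≡⟨ cong (f v +_) (sumF≡sum (f ∘ punchIn v)) ⟨
  f v + sumF (f ∘ punchIn v)  ∎
  where open ≡-Reasoning

sumF-mono : ∀ {n} {f g : Fin n → ℕ} → (∀ i → f i ≤ g i) → sumF f ≤ sumF g
sumF-mono {zero}  _   = z≤n
sumF-mono {suc n} f≤g = +-mono-≤ (f≤g fzero) (sumF-mono (f≤g ∘ fsuc))

sumF-≤ : ∀ {n} c {f : Fin n → ℕ} → (∀ i → f i ≤ c) → sumF f ≤ n * c
sumF-≤ {zero}  c _   = z≤n
sumF-≤ {suc n} c f≤c = +-mono-≤ (f≤c fzero) (sumF-≤ c (f≤c ∘ fsuc))

𝟙 : Bool → ℕ
𝟙 b = if b then 1 else 0

𝟙≤1 : ∀ b → 𝟙 b ≤ 1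
𝟙≤1 true  = ≤-refl
𝟙≤1 false = z≤n

𝟙-∧-≤ : ∀ a b c → 𝟙 (a ∧ b ∧ c) ≤ 𝟙 (a ∧ b)
𝟙-∧-≤ true  true  c = 𝟙≤1 c
𝟙-∧-≤ true  false c = z≤n
𝟙-∧-≤ false b     c = z≤n

𝟙-∧-complement : ∀ a c {c'} r → (a ≡ true → c' ≡ not c) →
                 𝟙 (a ∧ c ∧ r) + 𝟙 (a ∧ c' ∧ r) ≡ 𝟙 (a ∧ r)
𝟙-∧-complement false c     r _ = refl
𝟙-∧-complement true  true  r c'≡¬c with c'≡¬c refl
... | refl = +-identityʳ (𝟙 r)
𝟙-∧-complement true  false r c'≡¬c with c'≡¬c refl
... | refl = refl

𝟙-≤-∧-not : ∀ a f → 𝟙 a ≤ 𝟙 (a ∧ not f) + 𝟙 f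
𝟙-≤-∧-not true  true  = ≤-refl
𝟙-≤-∧-not true  false = ≤-refl
𝟙-≤-∧-not false f     = z≤n

countF-≤ : ∀ {n} (p : Fin n → Bool) → countF p ≤ n
countF-≤ {n} p = subst (countF p ≤_) (*-identityʳ n) (sumF-≤ 1 (𝟙≤1 ∘ p))

countF-lookup : ∀ {n} (X : Subset n) → countF (lookup X) ≡ ∣ X ∣
countF-lookup []            = refl
countF-lookup (inside ∷ X)  = cong suc (countF-lookup X)
countF-lookup (outside ∷ X) = countF-lookup X

<ᵇ-true : ∀ {m n} → m < n → (m <ᵇ n) ≡ true
<ᵇ-true m<n = Equivalence.to T-≡ (<⇒<ᵇ m<n)

<ᵇ-false : ∀ {m n} → ¬ m < n → (m <ᵇ n) ≡ false
<ᵇ-false {m} {n} m≮n = ¬-not (m≮n ∘ <ᵇ⇒< m n ∘ Equivalence.from T-≡)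

Undirected : ∀ {n} → (Fin n → Fin n → Bool) → Set
Undirected e = (∀ i j → e i j ≡ e j i) × (∀ i → e i i ≡ false)

upper : ∀ {n} → (Fin n → Fin n → Bool) → Fin n → Fin n → ℕ
upper e i j = 𝟙 ((toℕ i <ᵇ toℕ j) ∧ e i j)

edgeCount : ∀ {n} → (Fin n → Fin n → Bool) → ℕ
edgeCount e = sumF λ i → sumF (upper e i)

edgeCount-≤ : ∀ {n} (e : Fin n → Fin n → Bool) → edgeCount e ≤ n * n
edgeCount-≤ e = sumF-≤ _ λ i → countF-≤ λ j → (toℕ i <ᵇ toℕ j) ∧ e i j

𝟙-ordered-pair : ∀ {n} {i j : Fin n} → i ≢ j → ∀ b →
                 𝟙 ((toℕ i <ᵇ toℕ j) ∧ b) + 𝟙 ((toℕ j <ᵇ toℕ i) ∧ b) ≡ 𝟙 b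
𝟙-ordered-pair {i = i} {j} i≢j b with <-cmpᶠ i j
... | tri< i<j _ j≮i rewrite <ᵇ-true i<j | <ᵇ-false j≮i = +-identityʳ (𝟙 b)
... | tri≈ _ i≡j _   = contradiction i≡j i≢j
... | tri> i≮j _ j<i rewrite <ᵇ-false i≮j | <ᵇ-true j<i = refl

edgeCount-punchIn : ∀ {n} {e : Fin (suc n) → Fin (suc n) → Bool} → Undirected e → ∀ v →
  edgeCount e ≡ countF (e v) + sumF (λ i → sumF (λ j → upper e (punchIn v i) (punchIn v j)))
edgeCount-punchIn {e = e} (e-sym , e-irrefl) v = begin
  sumF (λ i → sumF (upper e i))
    ≡⟨ sumF-punchIn v (λ i → sumF (upper e i)) ⟩
  sumF (upper e v) + sumF (λ i → sumF (upper e (v' i)))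
    ≡⟨ cong₂ _+_ row-v (sumF-cong λ i → sumF-punchIn v (upper e (v' i))) ⟩
  row + sumF (λ i → upper e (v' i) v + sumF (upper e (v' i) ∘ v'))
    ≡⟨ cong (row +_) (sumF-+ (λ i → upper e (v' i) v) (λ i → sumF (upper e (v' i) ∘ v'))) ⟩
  row + (column + rest)
    ≡⟨ +-assoc row column rest ⟨
  (row + column) + rest
    ≡⟨ cong (_+ rest) (sumF-+ (λ j → upper e v (v' j)) (λ j → upper e (v' j) v)) ⟨
  sumF (λ j → upper e v (v' j) + upper e (v' j) v) + rest
    ≡⟨ cong (_+ rest) (sumF-cong pair) ⟩
  sumF (λ j → 𝟙 (e v (v' j))) + rest
    ≡⟨ cong (λ b → 𝟙 b + sumF (λ j → 𝟙 (e v (v' j))) + rest) (e-irrefl v) ⟨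
  (𝟙 (e v v) + sumF (λ j → 𝟙 (e v (v' j)))) + rest
    ≡⟨ cong (_+ rest) (sumF-punchIn v (𝟙 ∘ e v)) ⟨
  countF (e v) + rest ∎
  where
  open ≡-Reasoning
  v' = punchIn v
  row    = sumF λ j → upper e v (v' j)
  column = sumF λ i → upper e (v' i) v
  rest   = sumF λ i → sumF λ j → upper e (v' i) (v' j)
  upper-diagonal : upper e v v ≡ 0
  upper-diagonal = trans (cong (λ b → 𝟙 ((toℕ v <ᵇ toℕ v) ∧ b)) (e-irrefl v)) (cong 𝟙 (∧-zeroʳ _))
  row-v : sumF (upper e v) ≡ row
  row-v = trans (sumF-punchIn v (upper e v)) (cong (_+ row) upper-diagonal)
  pair : ∀ j → upper e v (v' j) + upper e (v' j) v ≡ 𝟙 (e v (v' j))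
  pair j rewrite e-sym (v' j) v = 𝟙-ordered-pair (punchInᵢ≢i v j ∘ sym) (e v (v' j))

edgeCount-exchange : ∀ {n} {e e' : Fin n → Fin n → Bool} → Undirected e → Undirected e' →
  ∀ v → (∀ i j → i ≢ v → j ≢ v → e i j ≡ e' i j) →
  edgeCount e + countF (e' v) ≡ edgeCount e' + countF (e v)
edgeCount-exchange {zero}           _  _   () _
edgeCount-exchange {suc n} {e} {e'} ue ue' v agree = begin
  edgeCount e + d'          ≡⟨ cong (_+ d') (edgeCount-punchIn ue v) ⟩
  (d + rest e) + d'         ≡⟨ cong (λ r → (d + r) + d') rest-agree ⟩
  (d + rest e') + d'        ≡⟨ swap d (rest e') d' ⟩
  (d' + rest e') + d        ≡⟨ cong (_+ d) (edgeCount-punchIn ue' v) ⟨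
  edgeCount e' + d          ∎
  where
  open ≡-Reasoning
  d  = countF (e v)
  d' = countF (e' v)
  rest : (Fin (suc n) → Fin (suc n) → Bool) → ℕ
  rest f = sumF λ i → sumF λ j → upper f (punchIn v i) (punchIn v j)
  rest-agree : rest e ≡ rest e'
  rest-agree = sumF-cong λ i → sumF-cong λ j →
    cong (λ b → 𝟙 ((toℕ (punchIn v i) <ᵇ toℕ (punchIn v j)) ∧ b))
         (agree _ _ (punchInᵢ≢i v i) (punchInᵢ≢i v j))
  swap : ∀ a r b → (a + r) + b ≡ (b + r) + a
  swap = solve-∀

crosses-flip : ∀ {n} (S : Subset n) v j → j ≢ v → crosses (flip S v) v j ≡ not (crosses S v j)
crosses-flip S v j j≢v = begin
  lookup (flip S v) v xor lookup (flip S v) j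
    ≡⟨ cong₂ _xor_ (lookup∘updateAt v S) (lookup∘updateAt′ j v j≢v S) ⟩
  not (lookup S v) xor lookup S j
    ≡⟨ not-distribˡ-xor (lookup S v) (lookup S j) ⟨
  not (crosses S v j) ∎
  where open ≡-Reasoning

crosses-flip-away : ∀ {n} (S : Subset n) v i j → i ≢ v → j ≢ v → crosses (flip S v) i j ≡ crosses S i j
crosses-flip-away S v i j i≢v j≢v =
  cong₂ _xor_ (lookup∘updateAt′ i v i≢v S) (lookup∘updateAt′ j v j≢v S)

module _ {n} (G : Graph n) where

  survivingCutEdge : Subset n → Subset n → Fin n → Fin n → Bool
  survivingCutEdge F S i j = adj G i j ∧ crosses S i j ∧ not (lookup F i) ∧ not (lookup F j)

  -- For v ∉ F, degCutWithout F S v is d_{S−F,G−F}(v) and degWithout F v the degree of v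
  -- in G − F; for v ∈ F both are 0.
  degCutWithout : Subset n → Subset n → Fin n → ℕ
  degCutWithout F S v = countF (survivingCutEdge F S v)

  degWithout : Subset n → Fin n → ℕ
  degWithout F v = countF λ j → adj G v j ∧ not (lookup F v) ∧ not (lookup F j)

  survivingCutEdge-undirected : ∀ F S → Undirected (survivingCutEdge F S)
  survivingCutEdge-undirected F S = symmetric , irreflexive
    where
    symmetric : ∀ i j → survivingCutEdge F S i j ≡ survivingCutEdge F S j i
    symmetric i j = cong₂ _∧_ (Graph.sym G i j)
      (cong₂ _∧_ (xor-comm (lookup S i) (lookup S j)) (∧-comm (not (lookup F i)) (not (lookup F j))))
    irreflexive : ∀ i → survivingCutEdge F S i i ≡ false
    irreflexive i = cong (_∧ _) (irrefl G i)

  cutWithout-flip : ∀ F S v →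
    cutWithout G F S + degCutWithout F (flip S v) v ≡ cutWithout G F (flip S v) + degCutWithout F S v
  cutWithout-flip F S v =
    edgeCount-exchange (survivingCutEdge-undirected F S) (survivingCutEdge-undirected F (flip S v)) v agree
    where
    agree : ∀ i j → i ≢ v → j ≢ v → survivingCutEdge F S i j ≡ survivingCutEdge F (flip S v) i j
    agree i j i≢v j≢v = cong (λ c → adj G i j ∧ c ∧ not (lookup F i) ∧ not (lookup F j))
                             (sym (crosses-flip-away S v i j i≢v j≢v))

  degCutWithout-flip : ∀ F S v → degCutWithout F S v + degCutWithout F (flip S v) v ≡ degWithout F v
  degCutWithout-flip F S v =
    trans (sym (sumF-+ (𝟙 ∘ survivingCutEdge F S v) (𝟙 ∘ survivingCutEdge F (flip S v) v)))
          (sumF-cong complement)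
    where
    flipped : ∀ j → adj G v j ≡ true → crosses (flip S v) v j ≡ not (crosses S v j)
    flipped j vj with j ≟ v
    ... | yes refl = contradiction (trans (sym (irrefl G j)) vj) λ ()
    ... | no j≢v = crosses-flip S v j j≢v
    complement : ∀ j → 𝟙 (survivingCutEdge F S v j) + 𝟙 (survivingCutEdge F (flip S v) v j)
                     ≡ 𝟙 (adj G v j ∧ not (lookup F v) ∧ not (lookup F j))
    complement j = 𝟙-∧-complement (adj G v j) (crosses S v j) (not (lookup F v) ∧ not (lookup F j)) (flipped j)

  degCutWithout-≤-degCut : ∀ F S v → degCutWithout F S v ≤ degCut G S v
  degCutWithout-≤-degCut F S v =
    sumF-mono λ j → 𝟙-∧-≤ (adj G v j) (crosses S v j) (not (lookup F v) ∧ not (lookup F j))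

  deg-≤-degWithout : ∀ F v → lookup F v ≡ false → deg G v ≤ degWithout F v + ∣ F ∣
  deg-≤-degWithout F v v∉F = begin
    deg G v
      ≤⟨ sumF-mono (λ j → 𝟙-≤-∧-not (adj G v j) (lookup F j)) ⟩
    sumF (λ j → 𝟙 (adj G v j ∧ not (lookup F j)) + 𝟙 (lookup F j))
      ≡⟨ sumF-+ (λ j → 𝟙 (adj G v j ∧ not (lookup F j))) (𝟙 ∘ lookup F) ⟩
    sumF (λ j → 𝟙 (adj G v j ∧ not (lookup F j))) + countF (lookup F)
      ≡⟨ cong₂ _+_ (sumF-cong λ j → cong (λ b → 𝟙 (adj G v j ∧ not b ∧ not (lookup F j)))
                                         (sym v∉F))
                   (countF-lookup F) ⟩
    degWithout F v + ∣ F ∣ ∎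
    where open ≤-Reasoning

  degCutWithout-inside : ∀ F S v → lookup F v ≡ true → degCutWithout F S v ≡ 0
  degCutWithout-inside F S v v∈F =
    n≤0⇒n≡0 (subst (degCutWithout F S v ≤_) (*-zeroʳ n) (sumF-≤ 0 (≤-reflexive ∘ vanish)))
    where
    vanish : ∀ j → 𝟙 (survivingCutEdge F S v j) ≡ 0
    vanish j = trans (cong (λ b → 𝟙 (adj G v j ∧ crosses S v j ∧ not b ∧ not (lookup F j))) v∈F)
                     (cong 𝟙 (trans (cong (adj G v j ∧_) (∧-zeroʳ (crosses S v j))) (∧-zeroʳ (adj G v j))))

  cutWithout-greedy-gain : ∀ k F S v → lookup F v ≡ false → GreedyCond G k S v →
    cutWithout G F S + k ≤ cutWithout G F (flip S v) + ∣ F ∣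
  cutWithout-greedy-gain k F S v v∉F greedy = +-cancelʳ-≤ P _ _ (begin
    (cutWithout G F S + k) + P      ≡⟨ xy∙z≈xz∙y (cutWithout G F S) k P ⟩
    (cutWithout G F S + P) + k      ≡⟨ +-assoc (cutWithout G F S) P k ⟩
    cutWithout G F S + (P + k)      ≤⟨ +-monoʳ-≤ (cutWithout G F S) local-gain ⟩
    cutWithout G F S + (P' + ∣ F ∣) ≡⟨ +-assoc (cutWithout G F S) P' ∣ F ∣ ⟨
    (cutWithout G F S + P') + ∣ F ∣ ≡⟨ cong (_+ ∣ F ∣) (cutWithout-flip F S v) ⟩
    (cutWithout G F S⊕v + P) + ∣ F ∣  ≡⟨ xy∙z≈xz∙y (cutWithout G F S⊕v) P ∣ F ∣ ⟩
    (cutWithout G F S⊕v + ∣ F ∣) + P  ∎)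
    where
    open ≤-Reasoning
    S⊕v = flip S v
    d  = degCut G S v
    P  = degCutWithout F S v
    P' = degCutWithout F S⊕v v
    P≤d = degCutWithout-≤-degCut F S v
    double : ∀ d k → d + (d + k) ≡ 2 * d + k
    double = solve-∀
    local-gain : P + k ≤ P' + ∣ F ∣
    local-gain = +-cancelˡ-≤ P _ _ (begin
      P + (P + k)              ≤⟨ +-mono-≤ P≤d (+-monoˡ-≤ k P≤d) ⟩
      d + (d + k)              ≡⟨ double d k ⟩
      2 * d + k                ≤⟨ greedy ⟩
      deg G v                  ≤⟨ deg-≤-degWithout F v v∉F ⟩
      degWithout F v + ∣ F ∣   ≡⟨ cong (_+ ∣ F ∣) (degCutWithout-flip F S v) ⟨
      (P + P') + ∣ F ∣         ≡⟨ +-assoc P P' ∣ F ∣ ⟩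
      P + (P' + ∣ F ∣)         ∎)

  cutWithout-greedy-mono : ∀ k F S v → ∣ F ∣ ≤ k → GreedyCond G k S v →
    cutWithout G F S ≤ cutWithout G F (flip S v)
  cutWithout-greedy-mono k F S v ∣F∣≤k greedy with lookup F v in v∈F?
  ... | false = +-cancelʳ-≤ k _ _
    (≤-trans (cutWithout-greedy-gain k F S v v∈F? greedy) (+-monoʳ-≤ (cutWithout G F (flip S v)) ∣F∣≤k))
  ... | true = begin
    cutWithout G F S                                     ≤⟨ m≤m+n (cutWithout G F S) _ ⟩
    cutWithout G F S + degCutWithout F (flip S v) v      ≡⟨ cutWithout-flip F S v ⟩
    cutWithout G F (flip S v) + degCutWithout F S v
      ≡⟨ cong (cutWithout G F (flip S v) +_) (degCutWithout-inside F S v v∈F?) ⟩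
    cutWithout G F (flip S v) + 0                        ≡⟨ +-identityʳ _ ⟩
    cutWithout G F (flip S v)                            ∎
    where open ≤-Reasoning

  cutWithout-⊥ : ∀ S → cutWithout G ⊥ S ≡ cutValue G S
  cutWithout-⊥ S = sumF-cong λ i → sumF-cong λ j →
    cong (λ b → 𝟙 ((toℕ i <ᵇ toℕ j) ∧ adj G i j ∧ b))
      (trans (cong₂ (λ x y → crosses S i j ∧ not x ∧ not y)
                    (lookup-replicate i outside) (lookup-replicate j outside))
             (∧-identityʳ (crosses S i j)))

  cutValue-greedy-gain : ∀ k S v → GreedyCond G k S v → cutValue G S + k ≤ cutValue G (flip S v)
  cutValue-greedy-gain k S v greedy = begin
    cutValue G S + k                     ≡⟨ cong (_+ k) (cutWithout-⊥ S) ⟨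
    cutWithout G ⊥ S + k                 ≤⟨ cutWithout-greedy-gain k ⊥ S v (lookup-replicate v outside) greedy ⟩
    cutWithout G ⊥ (flip S v) + ∣ ⊥ {n} ∣   ≡⟨ cong₂ _+_ (cutWithout-⊥ (flip S v)) (∣⊥∣≡0 n) ⟩
    cutValue G (flip S v) + 0            ≡⟨ +-identityʳ _ ⟩
    cutValue G (flip S v)                ∎
    where open ≤-Reasoning

Star-mono : ∀ {a r} {A : Set a} {R : Rel A r} (μ : A → ℕ) →
            (∀ {x y} → R x y → μ x ≤ μ y) → ∀ {x y} → Star R x y → μ x ≤ μ y
Star-mono μ step = fold (λ x y → μ x ≤ μ y) (λ r le → ≤-trans (step r) le) ≤-refl

normalForm : ∀ {a r} {A : Set a} {R : Rel A r} (μ : A → ℕ) (bound : ℕ) →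
  (∀ x → μ x ≤ bound) → (∀ {x y} → R x y → μ x < μ y) → (∀ x → Dec (∃ (R x))) →
  ∀ x → ∃ λ y → Star R x y × (∀ z → ¬ R y z)
normalForm {R = R} μ bound μ≤bound increasing step? x = run bound x (m≤n+m bound (μ x))
  where
  run : ∀ fuel x → bound ≤ μ x + fuel → ∃ λ y → Star R x y × (∀ z → ¬ R y z)
  run fuel x _ with step? x
  ... | no stuck = x , ε , λ z r → stuck (z , r)
  run zero x bound≤μx+0 | yes (y , r) = contradiction μy≤μx (<⇒≱ (increasing r))
    where
    μy≤μx : μ y ≤ μ x
    μy≤μx = ≤-trans (μ≤bound y) (≤-trans bound≤μx+0 (≤-reflexive (+-identityʳ (μ x))))
  run (suc fuel) x bound≤μx+1+fuel | yes (y , r) =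
    let z , steps , final = run fuel y bound≤μy+fuel in z , r ◅ steps , final
    where
    bound≤μy+fuel : bound ≤ μ y + fuel
    bound≤μy+fuel = ≤-trans bound≤μx+1+fuel
                      (≤-trans (≤-reflexive (+-suc (μ x) fuel)) (+-monoˡ-≤ fuel (increasing r)))

module _ {c ℓ₁ ℓ₂} (O : TotalPreorder c ℓ₁ ℓ₂) where
  open TotalPreorder O using (Carrier; _≲_; total) renaming (refl to ≲-refl; trans to ≲-trans)

  Subset-argmax : ∀ {n} (f : Subset n → Carrier) → ∃ λ x → ∀ y → f y ≲ f x
  Subset-argmax {zero} f = [] , λ { [] → ≲-refl }
  Subset-argmax {suc n} f with Subset-argmax (f ∘ (inside ∷_)) | Subset-argmax (f ∘ (outside ∷_))
  ... | a , a-max | b , b-max with total (f (inside ∷ a)) (f (outside ∷ b))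
  ... | inj₁ a≲b = outside ∷ b , λ { (inside ∷ y) → ≲-trans (a-max y) a≲b ; (outside ∷ y) → b-max y }
  ... | inj₂ b≲a = inside ∷ a , λ { (inside ∷ y) → a-max y ; (outside ∷ y) → ≲-trans (b-max y) b≲a }

module _ {n} (G : Graph n) (k : ℕ) where

  greedyStep? : ∀ S → Dec (∃ (GreedyStep G k S))
  greedyStep? S = map′ (λ (v , greedy) → flip S v , v , greedy , refl) (λ (_ , v , greedy , _) → v , greedy)
                       (any? λ v → 2 * degCut G S v + k ≤? deg G v)

  greedyStep-cutValue-gain : ∀ {S T} → GreedyStep G k S T → cutValue G S + k ≤ cutValue G T
  greedyStep-cutValue-gain {S} (v , greedy , refl) = cutValue-greedy-gain G k S v greedy

  greedyStep-cutWithout-mono : ∀ F {S T} → ∣ F ∣ ≤ k → GreedyStep G k S T →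
                               cutWithout G F S ≤ cutWithout G F T
  greedyStep-cutWithout-mono F {S} ∣F∣≤k (v , greedy , refl) = cutWithout-greedy-mono G k F S v ∣F∣≤k greedy

  stabilizeCut-terminates : 1 ≤ k → ∀ S → ∃ (StabilizeOutput G k S)
  stabilizeCut-terminates k≥1 =
    normalForm (cutValue G) (n * n) (λ S → edgeCount-≤ λ i j → adj G i j ∧ crosses S i j)
      (λ step → <-≤-trans (m<m+n _ k≥1) (greedyStep-cutValue-gain step))
      greedyStep?

  noGreedyStep⇒Stable : ∀ {S} → (∀ T → ¬ GreedyStep G k S T) → Stable G k S
  noGreedyStep⇒Stable {S} final v = ≰⇒> λ greedy → final (flip S v) (v , greedy , refl)

  greedySteps-cutValue-mono : ∀ {S S'} → Star (GreedyStep G k) S S' → cutValue G S ≤ cutValue G S'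
  greedySteps-cutValue-mono =
    Star-mono (cutValue G) λ step → ≤-trans (m≤m+n _ k) (greedyStep-cutValue-gain step)

  greedySteps-cutWithout-mono : ∀ F {S S'} → ∣ F ∣ ≤ k → Star (GreedyStep G k) S S' →
                                cutWithout G F S ≤ cutWithout G F S'
  greedySteps-cutWithout-mono F ∣F∣≤k =
    Star-mono (cutWithout G F) (greedyStep-cutWithout-mono F ∣F∣≤k)

  greedySteps-φ-mono : ∀ {S S' m m'} → Star (GreedyStep G k) S S' →
                       IsPhi G S k m → IsPhi G S' k m' → m ≤ m'
  greedySteps-φ-mono steps (_ , m≤) ((F , ∣F∣≡k , refl) , _) =
    ≤-trans (m≤ F ∣F∣≡k) (greedySteps-cutWithout-mono F (≤-reflexive ∣F∣≡k) steps)

  -- Sets F of the wrong size are assigned n * n, which bounds every cut, so they never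
  -- undercut the minimum defining φ(S,k).
  candidateCut : Subset n → Subset n → ℕ
  candidateCut S F = if ∣ F ∣ ≡ᵇ k then cutWithout G F S else n * n

  minimiser : ∀ S → ∃ λ F₀ → ∀ F → candidateCut S F₀ ≤ candidateCut S F
  minimiser S = Subset-argmax (Flip.totalPreorder ≤-totalPreorder) (candidateCut S)

  φ : Subset n → ℕ
  φ S = candidateCut S (proj₁ (minimiser S))

  candidateCut-size : ∀ S F → ∣ F ∣ ≡ k → candidateCut S F ≡ cutWithout G F S
  candidateCut-size S F ∣F∣≡k with ∣ F ∣ ≡ᵇ k in size
  ... | true  = refl
  ... | false = contradiction (subst T size (≡⇒≡ᵇ _ _ ∣F∣≡k)) λ ()

  φ-≤-cutWithout : ∀ S F → ∣ F ∣ ≡ k → φ S ≤ cutWithout G F S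
  φ-≤-cutWithout S F ∣F∣≡k =
    ≤-trans (proj₂ (minimiser S) F) (≤-reflexive (candidateCut-size S F ∣F∣≡k))

  IsPhi⇒≤φ : ∀ S {m} → IsPhi G S k m → m ≤ φ S
  IsPhi⇒≤φ S ((W , _ , refl) , m≤) = ≤-candidate (proj₁ (minimiser S))
    where
    ≤-candidate : ∀ F → cutWithout G W S ≤ candidateCut S F
    ≤-candidate F with ∣ F ∣ ≡ᵇ k in size
    ... | true  = m≤ F (≡ᵇ⇒≡ _ _ (subst T (sym size) _))
    ... | false = edgeCount-≤ (survivingCutEdge G W S)

  stable-φ-maximiser : 1 ≤ k →
    ∃ λ S* → Stable G k S* × (∀ S m m* → IsPhi G S k m → IsPhi G S* k m* → m ≤ m*)
  stable-φ-maximiser k≥1 with Subset-argmax ≤-totalPreorder φ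
  ... | S₀ , S₀-max with stabilizeCut-terminates k≥1 S₀
  ... | S* , steps* , final* = S* , noGreedyStep⇒Stable final* , φ-maximal
    where
    φ-maximal : ∀ S m m* → IsPhi G S k m → IsPhi G S* k m* → m ≤ m*
    φ-maximal S m m* isPhi ((F , ∣F∣≡k , refl) , _) = begin
      m                   ≤⟨ IsPhi⇒≤φ S isPhi ⟩
      φ S                 ≤⟨ S₀-max S ⟩
      φ S₀                ≤⟨ φ-≤-cutWithout S₀ F ∣F∣≡k ⟩
      cutWithout G F S₀   ≤⟨ greedySteps-cutWithout-mono F (≤-reflexive ∣F∣≡k) steps* ⟩
      cutWithout G F S*   ∎
      where open ≤-Reasoning

corollary11 : ∀ {n} (G : Graph n) (S : Subset n) (k : ℕ) → 1 ≤ k →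
    ((∃ λ S' → StabilizeOutput G k S S')
     × (∀ S' → StabilizeOutput G k S S' →
          Stable G k S'
          × cutValue G S ≤ cutValue G S'
          × (∀ m m' → IsPhi G S k m → IsPhi G S' k m' → m ≤ m')))
    × (∃ λ S* → Stable G k S*
          × (∀ S'' m'' m* → IsPhi G S'' k m'' → IsPhi G S* k m* → m'' ≤ m*))
corollary11 G S k k≥1 =
    ( stabilizeCut-terminates G k k≥1 S
    , λ S' (steps , final) →
        ( noGreedyStep⇒Stable G k final
        , greedySteps-cutValue-mono G k steps
        , λ _ _ → greedySteps-φ-mono G k steps ) )
  , stable-φ-maximiser G k k≥1
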